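{- Let $G=(V,E)$ be a weakly connected oriented graph in which every vertex has (in-degree, out-degree) equal to $(2,2)$ or $(3,3)$, and suppose $G$ contains at least one vertex of degree $(2,2)$ and at least one vertex of degree $(3,3)$. Then there exist a vertex $v$ of degree $(2,2)$ and a vertex $a$ of degree $(3,3)$ with $(a,v)\in E$.
   Context: An oriented graph is a digraph with no 2-cycles and no self-loops. A vertex has degree $(a,b)$ if its in-degree is $a$ and its out-degree is $b$. -}

module Defs where

open import Data.Nat using (ℕ; zero; suc; _+_)
open import Data.Bool using (Bool; true; false)
open import Data.Fin using (Fin)
open import Data.List using (List; []; _∷_; map; allFin)
open import Data.Nat.ListAction using (sum)
open import Data.Product using (_×_; Σ-syntax; ∃-syntax)
open import Data.Sum using (_⊎_)
open import Relation.Binary.PropositionalEquality using (_≡_)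
open import Relation.Nullary using (¬_)

-- A finite digraph on vertex set Fin n, given by its adjacency relation:
-- E u v ≡ true  iff  (u , v) is an arc.
Digraph : ℕ → Set
Digraph n = Fin n → Fin n → Bool

Oriented : ∀ {n} → Digraph n → Set
Oriented {n} E =
  ((v : Fin n) → ¬ (E v v ≡ true)) ×
  ((u v : Fin n) → ¬ ((E u v ≡ true) × (E v u ≡ true)))

b2n : Bool → ℕ
b2n true  = 1
b2n false = 0

outdeg : ∀ {n} → Digraph n → Fin n → ℕ
outdeg {n} E v = sum (map (λ w → b2n (E v w)) (allFin n))

indeg : ∀ {n} → Digraph n → Fin n → ℕ
indeg {n} E v = sum (map (λ w → b2n (E w v)) (allFin n))

HasDegree : ∀ {n} → Digraph n → Fin n → ℕ → ℕ → Set
HasDegree E v a b = (indeg E v ≡ a) × (outdeg E v ≡ b)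

UAdj : ∀ {n} → Digraph n → Fin n → Fin n → Set
UAdj E u v = (E u v ≡ true) ⊎ (E v u ≡ true)

data UWalk {n} (E : Digraph n) : Fin n → Fin n → Set where
  here  : ∀ {u} → UWalk E u u
  step  : ∀ {u v w} → UAdj E u v → UWalk E v w → UWalk E u w

WeaklyConnected : ∀ {n} → Digraph n → Set
WeaklyConnected {n} E = (u v : Fin n) → UWalk E u v

-- The (3,3)-vertices form a set X on which in-degree equals out-degree, so by
-- double counting the arcs leaving X are exactly as many as the arcs entering
-- X. If no arc went from X to a (2,2)-vertex, no arc would cross the cut in
-- either direction, and then no walk of the underlying graph could get from a
-- (2,2)-vertex to a (3,3)-vertex, contradicting weak connectivity.
module Submission where

open import Defs
open import Data.Nat using (ℕ; zero; suc; _+_)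
open import Data.Nat.Properties
  using (_≟_; +-identityʳ; +-0-commutativeMonoid; +-cancelˡ-≡; m+n≡0⇒m≡0)
open import Data.Nat.ListAction using (sum)
open import Data.Bool using (Bool; true; false; not; _∧_)
open import Data.Bool.Properties using (∧-identityʳ; ∧-zeroʳ)
open import Data.Fin using (Fin; zero; suc)
open import Data.List using (tabulate)
open import Data.List.Properties using (map-tabulate)
open import Data.Product using (_×_; ∃-syntax; _,_)
open import Data.Sum using (_⊎_; inj₁; inj₂; [_,_]′)
open import Data.Empty using (⊥-elim)
open import Function using (_∘_; id; const)
open import Relation.Nullary using (¬_; yes; no)
open import Relation.Binary.PropositionalEquality
  using (_≡_; refl; sym; trans; cong; cong₂; module ≡-Reasoning)
open import Algebra.Properties.CommutativeMonoid.Sum +-0-commutativeMonoid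
  using (sum-syntax; sum-cong-≗; sum-remove; ∑-distrib-+; ∑-comm)

sum-tabulate : ∀ {n} (f : Fin n → ℕ) → sum (tabulate f) ≡ ∑[ i < n ] f i
sum-tabulate {zero}  f = refl
sum-tabulate {suc n} f = cong (f zero +_) (sum-tabulate (f ∘ suc))

∑≡0⇒≡0 : ∀ {n} (f : Fin n → ℕ) → ∑[ i < n ] f i ≡ 0 → ∀ i → f i ≡ 0
∑≡0⇒≡0 {suc n} f ∑f≡0 i = m+n≡0⇒m≡0 (f i) (trans (sym (sum-remove {i = i} f)) ∑f≡0)

∑≢0⇒∃≢0 : ∀ {n} (f : Fin n → ℕ) → ¬ ∑[ i < n ] f i ≡ 0 → ∃[ i ] ¬ f i ≡ 0
∑≢0⇒∃≢0 {zero}  f ∑f≢0 = ⊥-elim (∑f≢0 refl)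
∑≢0⇒∃≢0 {suc n} f ∑f≢0 with f zero ≟ 0
... | no  f₀≢0 = zero , f₀≢0
... | yes f₀≡0 with ∑≢0⇒∃≢0 (f ∘ suc) (∑f≢0 ∘ cong₂ _+_ f₀≡0)
...   | i , fᵢ≢0 = suc i , fᵢ≢0

∑∑≡0⇒≡0 : ∀ {m n} (f : Fin m → Fin n → ℕ) →
          ∑[ i < m ] ∑[ j < n ] f i j ≡ 0 → ∀ i j → f i j ≡ 0
∑∑≡0⇒≡0 f ∑∑f≡0 i = ∑≡0⇒≡0 (f i) (∑≡0⇒≡0 (λ i → ∑[ j < _ ] f i j) ∑∑f≡0 i)

∑∑≢0⇒∃≢0 : ∀ {m n} (f : Fin m → Fin n → ℕ) →
           ¬ ∑[ i < m ] ∑[ j < n ] f i j ≡ 0 → ∃[ i ] ∃[ j ] ¬ f i j ≡ 0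
∑∑≢0⇒∃≢0 f ∑∑f≢0 with ∑≢0⇒∃≢0 (λ i → ∑[ j < _ ] f i j) ∑∑f≢0
... | i , ∑fᵢ≢0 with ∑≢0⇒∃≢0 (f i) ∑fᵢ≢0
...   | j , fᵢⱼ≢0 = i , j , fᵢⱼ≢0

b2n-∧-splitʳ : ∀ a b c → b2n (a ∧ b) ≡ b2n (a ∧ b ∧ c) + b2n (a ∧ b ∧ not c)
b2n-∧-splitʳ false b     c     = refl
b2n-∧-splitʳ true  false c     = refl
b2n-∧-splitʳ true  true  false = refl
b2n-∧-splitʳ true  true  true  = refl

b2n-∧-splitˡ : ∀ a b c → b2n (b ∧ c) ≡ b2n (a ∧ b ∧ c) + b2n (not a ∧ b ∧ c)
b2n-∧-splitˡ false b c = refl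
b2n-∧-splitˡ true  b c = sym (+-identityʳ (b2n (b ∧ c)))

b2n-∧-not≢0 : ∀ {a b c} → ¬ b2n (a ∧ b ∧ not c) ≡ 0 → a ≡ true × b ≡ true × c ≡ false
b2n-∧-not≢0 {false}               ≢0 = ⊥-elim (≢0 refl)
b2n-∧-not≢0 {true} {false}        ≢0 = ⊥-elim (≢0 refl)
b2n-∧-not≢0 {true} {true} {true}  ≢0 = ⊥-elim (≢0 refl)
b2n-∧-not≢0 {true} {true} {false} _  = refl , refl , refl

b2n-∧-not≡0 : ∀ {a b c} → b ≡ true → c ≡ false → b2n (a ∧ b ∧ not c) ≡ 0 → a ≡ false
b2n-∧-not≡0 {false} refl refl _ = refl
b2n-∧-not≡0 {true}  refl refl ()

b2n-not-∧≡0 : ∀ {a b c} → a ≡ false → b ≡ true → b2n (not a ∧ b ∧ c) ≡ 0 → c ≡ false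
b2n-not-∧≡0 {c = false} refl refl _ = refl
b2n-not-∧≡0 {c = true}  refl refl ()

outdeg≡∑ : ∀ {n} (E : Digraph n) u → outdeg E u ≡ ∑[ v < n ] b2n (E u v)
outdeg≡∑ E u = trans (cong sum (map-tabulate id (b2n ∘ E u))) (sum-tabulate (b2n ∘ E u))

indeg≡∑ : ∀ {n} (E : Digraph n) v → indeg E v ≡ ∑[ u < n ] b2n (E u v)
indeg≡∑ E v = trans (cong sum (map-tabulate id (λ u → b2n (E u v)))) (sum-tabulate (λ u → b2n (E u v)))

UWalk-preserves : ∀ {n} {E : Digraph n} (P : Fin n → Set) →
  (∀ {u v} → UAdj E u v → P u → P v) → ∀ {u w} → UWalk E u w → P u → P w
UWalk-preserves P step-preserves here           Pu = Pu
UWalk-preserves P step-preserves (step uv walk) Pu =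
  UWalk-preserves P step-preserves walk (step-preserves uv Pu)

module Cut {n} (E : Digraph n) (X : Fin n → Bool) where

  Balanced : Set
  Balanced = ∀ v → X v ≡ true → indeg E v ≡ outdeg E v

  within leaving entering : Fin n → Fin n → ℕ
  within   u v = b2n (X u ∧ E u v ∧ X v)
  leaving  u v = b2n (X u ∧ E u v ∧ not (X v))
  entering u v = b2n (not (X u) ∧ E u v ∧ X v)

  arcsWithin arcsLeaving arcsEntering : ℕ
  arcsWithin   = ∑[ u < n ] ∑[ v < n ] within u v
  arcsLeaving  = ∑[ u < n ] ∑[ v < n ] leaving u v
  arcsEntering = ∑[ u < n ] ∑[ v < n ] entering u v

  arcsFromX≡within+leaving :
    ∑[ u < n ] ∑[ v < n ] b2n (X u ∧ E u v) ≡ arcsWithin + arcsLeaving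
  arcsFromX≡within+leaving = begin
    ∑[ u < n ] ∑[ v < n ] b2n (X u ∧ E u v)
      ≡⟨ sum-cong-≗ (λ u → sum-cong-≗ (λ v → b2n-∧-splitʳ (X u) (E u v) (X v))) ⟩
    ∑[ u < n ] ∑[ v < n ] (within u v + leaving u v)
      ≡⟨ sum-cong-≗ (λ u → ∑-distrib-+ (within u) (leaving u)) ⟩
    ∑[ u < n ] (∑[ v < n ] within u v + ∑[ v < n ] leaving u v)
      ≡⟨ ∑-distrib-+ (λ u → ∑[ v < n ] within u v) (λ u → ∑[ v < n ] leaving u v) ⟩
    arcsWithin + arcsLeaving ∎
    where open ≡-Reasoning

  arcsToX≡within+entering :
    ∑[ u < n ] ∑[ v < n ] b2n (E u v ∧ X v) ≡ arcsWithin + arcsEntering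
  arcsToX≡within+entering = begin
    ∑[ u < n ] ∑[ v < n ] b2n (E u v ∧ X v)
      ≡⟨ sum-cong-≗ (λ u → sum-cong-≗ (λ v → b2n-∧-splitˡ (X u) (E u v) (X v))) ⟩
    ∑[ u < n ] ∑[ v < n ] (within u v + entering u v)
      ≡⟨ sum-cong-≗ (λ u → ∑-distrib-+ (within u) (entering u)) ⟩
    ∑[ u < n ] (∑[ v < n ] within u v + ∑[ v < n ] entering u v)
      ≡⟨ ∑-distrib-+ (λ u → ∑[ v < n ] within u v) (λ u → ∑[ v < n ] entering u v) ⟩
    arcsWithin + arcsEntering ∎
    where open ≡-Reasoning

  outdegInX≡indegInX : Balanced →
    ∀ u → ∑[ v < n ] b2n (X u ∧ E u v) ≡ ∑[ w < n ] b2n (E w u ∧ X u)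
  outdegInX≡indegInX balanced u with X u in Xu
  ... | false = sum-cong-≗ (λ w → cong b2n (sym (∧-zeroʳ (E w u))))
  ... | true  = begin
    ∑[ v < n ] b2n (E u v)          ≡⟨ outdeg≡∑ E u ⟨
    outdeg E u                      ≡⟨ balanced u Xu ⟨
    indeg E u                       ≡⟨ indeg≡∑ E u ⟩
    ∑[ w < n ] b2n (E w u)          ≡⟨ sum-cong-≗ (λ w → cong b2n (∧-identityʳ (E w u))) ⟨
    ∑[ w < n ] b2n (E w u ∧ true)   ∎
    where open ≡-Reasoning

  arcsLeaving≡arcsEntering : Balanced → arcsLeaving ≡ arcsEntering
  arcsLeaving≡arcsEntering balanced = +-cancelˡ-≡ arcsWithin arcsLeaving arcsEntering (begin
    arcsWithin + arcsLeaving                   ≡⟨ arcsFromX≡within+leaving ⟨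
    ∑[ u < n ] ∑[ v < n ] b2n (X u ∧ E u v)    ≡⟨ sum-cong-≗ (outdegInX≡indegInX balanced) ⟩
    ∑[ v < n ] ∑[ u < n ] b2n (E u v ∧ X v)    ≡⟨ ∑-comm (λ u v → b2n (E u v ∧ X v)) ⟨
    ∑[ u < n ] ∑[ v < n ] b2n (E u v ∧ X v)    ≡⟨ arcsToX≡within+entering ⟩
    arcsWithin + arcsEntering                  ∎)
    where open ≡-Reasoning

  complement-unreachable : Balanced → arcsLeaving ≡ 0 →
    ∀ {u w} → UWalk E u w → X u ≡ false → X w ≡ false
  complement-unreachable balanced leaving≡0 = UWalk-preserves (λ v → X v ≡ false) closed
    where
    entering≡0 : arcsEntering ≡ 0
    entering≡0 = trans (sym (arcsLeaving≡arcsEntering balanced)) leaving≡0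

    closed : ∀ {u v} → UAdj E u v → X u ≡ false → X v ≡ false
    closed {u} {v} (inj₁ Euv) Xu = b2n-not-∧≡0 Xu Euv (∑∑≡0⇒≡0 entering entering≡0 u v)
    closed {u} {v} (inj₂ Evu) Xu = b2n-∧-not≡0 Evu Xu (∑∑≡0⇒≡0 leaving leaving≡0 v u)

  ∃-leaving-arc : WeaklyConnected E → Balanced → ∀ {x y} → X x ≡ true → X y ≡ false →
    ∃[ u ] ∃[ v ] (X u ≡ true × X v ≡ false × E u v ≡ true)
  ∃-leaving-arc connected balanced {x} {y} Xx Xy with arcsLeaving ≟ 0
  ... | no leaving≢0 with ∑∑≢0⇒∃≢0 leaving leaving≢0
  ...   | u , v , uv≢0 with b2n-∧-not≢0 uv≢0
  ...     | Xu , Euv , Xv = u , v , Xu , Xv , Euv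
  ∃-leaving-arc connected balanced {x} {y} Xx Xy | yes leaving≡0
    with trans (sym Xx) (complement-unreachable balanced leaving≡0 (connected y x) Xy)
  ... | ()

module DegreeClasses {n} (E : Digraph n)
  (deg : (v : Fin n) → HasDegree E v 2 2 ⊎ HasDegree E v 3 3) where

  is33 : Fin n → Bool
  is33 v = [ const false , const true ]′ (deg v)

  balanced : Cut.Balanced E is33
  balanced v is33v with deg v
  balanced v ()    | inj₁ _
  balanced v _     | inj₂ (in≡3 , out≡3) = trans in≡3 (sym out≡3)

  degree-22 : ∀ {v} → is33 v ≡ false → HasDegree E v 2 2
  degree-22 {v} is33v with deg v
  degree-22 {v} _  | inj₁ d = d
  degree-22 {v} () | inj₂ _

  degree-33 : ∀ {v} → is33 v ≡ true → HasDegree E v 3 3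
  degree-33 {v} is33v with deg v
  degree-33 {v} () | inj₁ _
  degree-33 {v} _  | inj₂ d = d

  is33-22 : ∀ {v} → HasDegree E v 2 2 → is33 v ≡ false
  is33-22 {v} (_ , out≡2) with deg v
  ... | inj₁ _ = refl
  ... | inj₂ (_ , out≡3) with trans (sym out≡2) out≡3
  ...   | ()

  is33-33 : ∀ {v} → HasDegree E v 3 3 → is33 v ≡ true
  is33-33 {v} (_ , out≡3) with deg v
  ... | inj₂ _ = refl
  ... | inj₁ (_ , out≡2) with trans (sym out≡2) out≡3
  ...   | ()

mainTheorem17 : (n : ℕ) (E : Digraph n) →
    Oriented E →
    WeaklyConnected E →
    ((v : Fin n) → HasDegree E v 2 2 ⊎ HasDegree E v 3 3) →
    ∃[ x ] HasDegree E x 2 2 →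
    ∃[ y ] HasDegree E y 3 3 →
    ∃[ v ] ∃[ a ] (HasDegree E v 2 2 × HasDegree E a 3 3 × E a v ≡ true)
mainTheorem17 n E _ connected deg (x , x22) (y , y33) =
  let a , v , a33 , v22 , Eav = ∃-leaving-arc connected balanced (is33-33 y33) (is33-22 x22)
  in  v , a , degree-22 v22 , degree-33 a33 , Eav
  where
  open DegreeClasses E deg
  open Cut E is33
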